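{- Let $G$ and $H$ be weighted graphs, let $s$ be a positive integer, and let $x_i \in V(G)$. Let $G_{i,s}'$ be the weighted graph obtained from $G$ by adding one new vertex $x'$ and a single edge $x_i x'$ of weight $s$. For a distribution $D$ on $G_{i,s}' \times H$, let $\phi(D)$ be the distribution on $G\times H$ given by $\phi(D)((x,y)) = D((x,y)) + sD((x',y))$ if $x = x_i$ and $\phi(D)((x,y)) = D((x,y))$ if $x\neq x_i$. If $D_0$ and $D_n$ are distributions on $G_{i,s}' \times H$ such that $D_n$ is reachable from $D_0$, then $\phi(D_n)$ is reachable from $\phi(D_0)$ in $G \times H$.
   Context: A weighted graph is a finite undirected graph $G$ with a function $w: E(G) \to \mathbb{N}^+$. A distribution is a function from the vertex set to $\mathbb{N}$ (numbers of pebbles). A pebbling move along an edge $e = xx'$ removes $w(e)$ pebbles from $x$ and places one pebble on $x'$. $D'$ is reachable from $D$ if a sequence of pebbling moves leads from $D$ to a distribution $D''$ with $D''(v)\ge D'(v)$ for all $v$. The Cartesian product of weighted graphs $G\times H$ has vertex set $V(G)\times V(H)$, edges $(x,y)(x,y')$ for $yy'\in E(H)$ with weight $w(yy')$ and $(x,y)(x',y)$ for $xx'\in E(G)$ with weight $w(xx')$. -}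

module Defs where

open import Data.Nat using (ℕ; zero; suc; _+_; _*_; _∸_; _≤_; _<_)
open import Data.Nat.Properties using (_≟_)
open import Data.Fin using (Fin)
open import Data.Maybe using (Maybe; just; nothing)
open import Data.Product using (Σ; _×_; _,_; ∃-syntax)
open import Data.Bool using (if_then_else_)
open import Relation.Nullary using (yes; no)
open import Relation.Nullary.Decidable using (⌊_⌋)
open import Relation.Binary.Definitions using (DecidableEquality)
open import Relation.Binary.PropositionalEquality using (_≡_; refl; sym)
open import Data.Empty using (⊥-elim)
open import Data.Product.Properties using () renaming (≡-dec to ×-≡-dec)
open import Data.Maybe.Properties using () renaming (≡-dec to Maybe-≡-dec)
open import Relation.Binary.Construct.Closure.ReflexiveTransitive using (Star)

-- A weighted (simple, undirected) graph on vertex type V.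
-- w x y = 0 means "no edge between x and y"; w x y > 0 is the weight of edge xy.
record WGraph (V : Set) : Set where
  field
    _≟V_   : DecidableEquality V
    w      : V → V → ℕ
    w-sym  : ∀ x y → w x y ≡ w y x
    w-loop : ∀ x → w x x ≡ 0

open WGraph public

ind : {V : Set} → DecidableEquality V → V → V → ℕ → ℕ
ind eq a b k with eq a b
... | yes _ = k
... | no _  = 0

Dist : Set → Set
Dist V = V → ℕ

Step : {V : Set} → WGraph V → Dist V → Dist V → Set
Step {V} G D E =
  Σ V λ u → Σ V λ v →
    (0 < w G u v) × (w G u v ≤ D u) ×
    (∀ z → E z ≡ (D z ∸ ind (_≟V_ G) z u (w G u v)) + ind (_≟V_ G) z v 1)

Reachable : {V : Set} → WGraph V → Dist V → Dist V → Set
Reachable {V} G D D' = ∃[ D'' ] (Star (Step G) D D'' × (∀ v → D' v ≤ D'' v))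

prodW : {A B : Set} → WGraph A → WGraph B → A × B → A × B → ℕ
prodW G H (x , y) (x' , y') with _≟V_ G x x' | _≟V_ H y y'
... | yes _ | _     = w H y y'
... | no _  | yes _ = w G x x'
... | no _  | no _  = 0

prodW-sym : {A B : Set} (G : WGraph A) (H : WGraph B) → ∀ p q → prodW G H p q ≡ prodW G H q p
prodW-sym G H (x , y) (x' , y') with _≟V_ G x x' | _≟V_ H y y' | _≟V_ G x' x | _≟V_ H y' y
... | yes _ | _ | yes _ | _ = w-sym H y y'
... | yes p | _ | no q | _ = ⊥-elim (q (sym p))
... | no p | _ | yes q | _ = ⊥-elim (p (sym q))
... | no _ | yes _ | no _ | yes _ = w-sym G x x'
... | no _ | yes p | no _ | no q = ⊥-elim (q (sym p))
... | no _ | no p | no _ | yes q = ⊥-elim (p (sym q))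
... | no _ | no _ | no _ | no _ = refl

prodW-loop : {A B : Set} (G : WGraph A) (H : WGraph B) → ∀ p → prodW G H p p ≡ 0
prodW-loop G H (x , y) with _≟V_ G x x | _≟V_ H y y
... | yes _ | _ = w-loop H y
... | no p | _ = ⊥-elim (p refl)

_×G_ : {A B : Set} → WGraph A → WGraph B → WGraph (A × B)
G ×G H = record
  { _≟V_   = ×-≡-dec (_≟V_ G) (_≟V_ H)
  ; w      = prodW G H
  ; w-sym  = prodW-sym G H
  ; w-loop = prodW-loop G H
  }

-- G'_{i,s}: add a new vertex x' (= nothing) joined to xi by an edge of weight s.
extW : {V : Set} → WGraph V → V → ℕ → Maybe V → Maybe V → ℕ
extW G xi s (just a) (just b) = w G a b
extW G xi s (just a) nothing  = ind (_≟V_ G) a xi s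
extW G xi s nothing  (just b) = ind (_≟V_ G) b xi s
extW G xi s nothing  nothing  = 0

extW-sym : {V : Set} (G : WGraph V) (xi : V) (s : ℕ) → ∀ p q → extW G xi s p q ≡ extW G xi s q p
extW-sym G xi s (just a) (just b) = w-sym G a b
extW-sym G xi s (just a) nothing  = refl
extW-sym G xi s nothing  (just b) = refl
extW-sym G xi s nothing  nothing  = refl

extW-loop : {V : Set} (G : WGraph V) (xi : V) (s : ℕ) → ∀ p → extW G xi s p p ≡ 0
extW-loop G xi s (just a) = w-loop G a
extW-loop G xi s nothing  = refl

addPendant : {V : Set} → WGraph V → V → ℕ → WGraph (Maybe V)
addPendant G xi s = record
  { _≟V_   = Maybe-≡-dec (_≟V_ G)
  ; w      = extW G xi s
  ; w-sym  = extW-sym G xi s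
  ; w-loop = extW-loop G xi s
  }

φ : {V B : Set} → WGraph V → V → ℕ → Dist (Maybe V × B) → Dist (V × B)
φ G xi s D (x , y) = D (just x , y) + ind (_≟V_ G) x xi (s * D (nothing , y))

module Submission where

-- It therefore suffices to show that φ carries every single
-- pebbling move of G'_{i,s} × H to something reachable in G × H; reachability
-- is transitive and monotone, so runs and the final "≥ D_n" comparison follow.
--
-- To avoid truncated subtraction, a move along uv is recorded in its balance
-- form  E + w(uv)·[u] = D + 1·[v],  where k·[u] is the point mass of k pebbles
-- on u.  The map φ is additive, sends point masses on (x, y) to point masses on
-- (x, y) and k·[(x', y)] to (s·k)·[(x_i, y)], so the balance of a move upstairs
-- becomes a balance downstairs.  Four kinds of moves remain:
--   * an edge of G × H itself: the same move downstairs;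
--   * an edge inside the copy {x'} × H: s parallel moves inside {x_i} × H;
--   * the pendant edge x_i → x' (weight s): φ D does not change;
--   * the pendant edge x' → x_i: s·s pebbles become one, so φ D only
--     decreases.

open import Defs
open import Data.Nat using (ℕ; zero; suc; _+_; _*_; _∸_; _≤_; _<_; z≤n)
open import Data.Nat.Properties
open import Data.Fin using (Fin)
open import Data.Maybe using (Maybe; just; nothing)
open import Data.Maybe.Properties using (just-injective)
open import Data.Product using (_×_; _,_; proj₁; proj₂; ∃-syntax)
open import Relation.Nullary using (yes; no; ¬_; contradiction)
open import Relation.Binary.Definitions using (DecidableEquality)
open import Relation.Binary.PropositionalEquality
open import Relation.Binary.Construct.Closure.ReflexiveTransitive using (Star; ε; _◅_; _◅◅_)
open import Algebra.Properties.CommutativeSemigroup +-commutativeSemigroup using (xy∙z≈xz∙y; interchange)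

module _ {V : Set} (eq : DecidableEquality V) where

  ind-yes : ∀ {a b} k → a ≡ b → ind eq a b k ≡ k
  ind-yes {a} {b} k a≡b with eq a b
  ... | yes _   = refl
  ... | no a≢b = contradiction a≡b a≢b

  ind-no : ∀ {a b} k → ¬ a ≡ b → ind eq a b k ≡ 0
  ind-no {a} {b} k a≢b with eq a b
  ... | yes a≡b = contradiction a≡b a≢b
  ... | no _    = refl

  ind-zero : ∀ a b → ind eq a b 0 ≡ 0
  ind-zero a b with eq a b
  ... | yes _ = refl
  ... | no _  = refl

  ind-+ : ∀ a b k l → ind eq a b (k + l) ≡ ind eq a b k + ind eq a b l
  ind-+ a b k l with eq a b
  ... | yes _ = refl
  ... | no _  = refl

  ind-* : ∀ a b c k → ind eq a b (c * k) ≡ c * ind eq a b k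
  ind-* a b c k with eq a b
  ... | yes _ = refl
  ... | no _  = sym (*-zeroʳ c)

  ind-mono : ∀ a b {k l} → k ≤ l → ind eq a b k ≤ ind eq a b l
  ind-mono a b k≤l with eq a b
  ... | yes _ = k≤l
  ... | no _  = z≤n

  ind-≤ : (f : V → ℕ) → ∀ a b {k} → k ≤ f b → ind eq a b k ≤ f a
  ind-≤ f a b k≤fb with eq a b
  ... | yes refl = k≤fb
  ... | no _     = z≤n

  ind-pos : ∀ a b {k} → 0 < ind eq a b k → a ≡ b
  ind-pos a b pos with eq a b
  ... | yes a≡b = a≡b
  ... | no _    = contradiction pos (<-irrefl refl)

ind-× : {A B : Set} (eqA : DecidableEquality A) (eqB : DecidableEquality B)
  (eqAB : DecidableEquality (A × B)) →
  ∀ a a' b b' k → ind eqAB (a , b) (a' , b') k ≡ ind eqA a a' (ind eqB b b' k)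
ind-× eqA eqB eqAB a a' b b' k with eqA a a' | eqB b b'
... | yes refl | yes refl = ind-yes eqAB k refl
... | yes refl | no b≢b'  = ind-no eqAB k (λ e → b≢b' (cong proj₂ e))
... | no a≢a'  | _        = ind-no eqAB _ (λ e → a≢a' (cong proj₁ e))

ind-just : {A : Set} (eqA : DecidableEquality A) (eqM : DecidableEquality (Maybe A)) →
  ∀ a b k → ind eqM (just a) (just b) k ≡ ind eqA a b k
ind-just eqA eqM a b k with eqA a b
... | yes refl = ind-yes eqM k refl
... | no a≢b   = ind-no eqM k (λ e → a≢b (just-injective e))

_≤ᴰ_ : {V : Set} → Dist V → Dist V → Set
D ≤ᴰ E = ∀ z → D z ≤ E z

mass : {V : Set} → WGraph V → V → ℕ → Dist V
mass T u k z = ind (_≟V_ T) z u k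

≤-by-balance : ∀ {e d a b} → e + a ≡ d + b → b ≤ a → e ≤ d
≤-by-balance {e} {d} {a} e+a≡d+b b≤a =
  +-cancelʳ-≤ a e d (≤-trans (≤-reflexive e+a≡d+b) (+-monoʳ-≤ d b≤a))

module _ {V : Set} (T : WGraph V) where

  edge-ends-differ : ∀ {p q} → 0 < w T p q → ¬ p ≡ q
  edge-ends-differ {p} pos refl = n≮0 (subst (0 <_) (w-loop T p) pos)

  balance : ∀ {D E : Dist V} u v k → k ≤ D u →
    (∀ z → E z ≡ (D z ∸ mass T u k z) + mass T v 1 z) →
    ∀ z → E z + mass T u k z ≡ D z + mass T v 1 z
  balance {D} {E} u v k k≤Du E≡ z = begin
    E z + m             ≡⟨ cong (_+ m) (E≡ z) ⟩
    (D z ∸ m) + n + m   ≡⟨ xy∙z≈xz∙y (D z ∸ m) n m ⟩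
    (D z ∸ m) + m + n   ≡⟨ cong (_+ n) (m∸n+n≡m (ind-≤ (_≟V_ T) D z u k≤Du)) ⟩
    D z + n             ∎
    where
    open ≡-Reasoning
    m n : ℕ
    m = mass T u k z
    n = mass T v 1 z

  replay : ∀ {D E D'} → Star (Step T) D E → D ≤ᴰ D' →
    ∃[ E' ] (Star (Step T) D' E' × E ≤ᴰ E')
  replay ε D≤D' = _ , ε , D≤D'
  replay {D' = D'} (_◅_ {j = E} (u , v , pos , k≤Du , E≡) run) D≤D' =
    let F' , run' , F≤F' = replay {D' = E'} run E≤E'
    in F' , (u , v , pos , ≤-trans k≤Du (D≤D' u) , λ _ → refl) ◅ run' , F≤F'
    where
    E' : Dist V
    E' z = (D' z ∸ mass T u (w T u v) z) + mass T v 1 z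
    E≤E' : E ≤ᴰ E'
    E≤E' z = subst (_≤ E' z) (sym (E≡ z))
      (+-monoˡ-≤ (mass T v 1 z) (∸-monoˡ-≤ (mass T u (w T u v) z) (D≤D' z)))

  reach-≤ : ∀ {D F} → F ≤ᴰ D → Reachable T D F
  reach-≤ F≤D = _ , ε , F≤D

  reach-step : ∀ {D E} → Step T D E → Reachable T D E
  reach-step st = _ , st ◅ ε , λ _ → ≤-refl

  reach-trans : ∀ {D E F} → Reachable T D E → Reachable T E F → Reachable T D F
  reach-trans (E' , run , E≤E') (F' , run₂ , F≤F') with replay run₂ E≤E'
  ... | F'' , run₃ , F'≤F'' = F'' , run ◅◅ run₃ , λ z → ≤-trans (F≤F' z) (F'≤F'' z)

  moves : ∀ {p q} c {D F} → 0 < w T p q →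
    (∀ z → F z + mass T p (c * w T p q) z ≤ D z + mass T q c z) → Reachable T D F
  moves {p} {q} zero {D} {F} _ bound = reach-≤ λ z →
    +-cancelʳ-≤ 0 (F z) (D z)
      (subst₂ (λ a b → F z + a ≤ D z + b) (ind-zero (_≟V_ T) z p) (ind-zero (_≟V_ T) z q) (bound z))
  moves {p} {q} (suc c) {D} {F} pos bound =
    reach-trans (reach-step (p , q , pos , k≤Dp , λ _ → refl)) (moves c pos bound₁)
    where
    open ≤-Reasoning
    k : ℕ
    k = w T p q
    D₁ : Dist V
    D₁ z = (D z ∸ mass T p k z) + mass T q 1 z
    p≢q : ¬ p ≡ q
    p≢q = edge-ends-differ pos
    -- the first move is affordable: bound at p says F p + (k + c·k) ≤ D p
    k≤Dp : k ≤ D p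
    k≤Dp = begin
      k                              ≤⟨ m≤m+n k (c * k) ⟩
      k + c * k                      ≡⟨ sym (ind-yes (_≟V_ T) {p} _ refl) ⟩
      mass T p (k + c * k) p         ≤⟨ m≤n+m _ (F p) ⟩
      F p + mass T p (k + c * k) p   ≤⟨ bound p ⟩
      D p + mass T q (suc c) p       ≡⟨ cong (D p +_) (ind-no (_≟V_ T) {p} {q} _ p≢q) ⟩
      D p + 0                        ≡⟨ +-identityʳ (D p) ⟩
      D p                            ∎
    bound₁ : ∀ z → F z + mass T p (c * k) z ≤ D₁ z + mass T q c z
    bound₁ z = +-cancelʳ-≤ (mass T p k z) _ _ (begin
      F z + mass T p (c * k) z + mass T p k z    ≡⟨ +-assoc (F z) _ _ ⟩
      F z + (mass T p (c * k) z + mass T p k z)  ≡⟨ cong (F z +_) (+-comm (mass T p (c * k) z) _) ⟩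
      F z + (mass T p k z + mass T p (c * k) z)  ≡⟨ cong (F z +_) (sym (ind-+ (_≟V_ T) z p k (c * k))) ⟩
      F z + mass T p (k + c * k) z               ≤⟨ bound z ⟩
      D z + mass T q (1 + c) z                   ≡⟨ cong (D z +_) (ind-+ (_≟V_ T) z q 1 c) ⟩
      D z + (mass T q 1 z + mass T q c z)        ≡⟨ sym (+-assoc (D z) _ _) ⟩
      D z + mass T q 1 z + mass T q c z
        ≡⟨ cong (_+ mass T q c z) (sym (balance p q k k≤Dp (λ _ → refl) z)) ⟩
      D₁ z + mass T p k z + mass T q c z         ≡⟨ xy∙z≈xz∙y (D₁ z) _ _ ⟩
      D₁ z + mass T q c z + mass T p k z         ∎)

  move : ∀ {p q D F} → 0 < w T p q →
    (∀ z → F z + mass T p (w T p q) z ≤ D z + mass T q 1 z) → Reachable T D F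
  move {p} {q} {D} {F} pos bound = moves 1 pos λ z →
    subst (λ j → F z + mass T p j z ≤ D z + mass T q 1 z) (sym (*-identityˡ (w T p q))) (bound z)

prodW-split : {A B : Set} (G : WGraph A) (H : WGraph B) → ∀ x x' y y' →
  w (G ×G H) (x , y) (x' , y') ≡ ind (_≟V_ G) x x' (w H y y') + ind (_≟V_ H) y y' (w G x x')
prodW-split G H x x' y y' with _≟V_ G x x' | _≟V_ H y y'
... | yes refl | yes refl = sym (trans (cong (w H y y +_) (w-loop G x)) (+-identityʳ (w H y y)))
... | yes refl | no _     = sym (+-identityʳ (w H y y'))
... | no _     | yes refl = refl
... | no _     | no _     = refl

module Pendant {V B : Set} (G : WGraph V) (H : WGraph B) (s : ℕ) (xi : V) where

  G' : WGraph (Maybe V)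
  G' = addPendant G xi s

  S : WGraph (Maybe V × B)
  S = G' ×G H

  T : WGraph (V × B)
  T = G ×G H

  Φ : Dist (Maybe V × B) → Dist (V × B)
  Φ = φ G xi s

  w-inner : ∀ a b y y' → w S (just a , y) (just b , y') ≡ w T (a , y) (b , y')
  w-inner a b y y' = begin
    w S (just a , y) (just b , y')
      ≡⟨ prodW-split G' H (just a) (just b) y y' ⟩
    ind (_≟V_ G') (just a) (just b) (w H y y') + ind (_≟V_ H) y y' (w G a b)
      ≡⟨ cong (_+ ind (_≟V_ H) y y' (w G a b)) (ind-just (_≟V_ G) (_≟V_ G') a b (w H y y')) ⟩
    ind (_≟V_ G) a b (w H y y') + ind (_≟V_ H) y y' (w G a b)
      ≡⟨ sym (prodW-split G H a b y y') ⟩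
    w T (a , y) (b , y') ∎
    where open ≡-Reasoning

  w-fibre : ∀ y y' → w S (nothing , y) (nothing , y') ≡ w T (xi , y) (xi , y')
  w-fibre y y' = begin
    w S (nothing , y) (nothing , y')
      ≡⟨ prodW-split G' H nothing nothing y y' ⟩
    ind (_≟V_ G') nothing nothing (w H y y') + ind (_≟V_ H) y y' 0
      ≡⟨ cong₂ _+_ (trans (ind-yes (_≟V_ G') {nothing} _ refl) (sym (ind-yes (_≟V_ G) {xi} _ refl)))
                   (cong (ind (_≟V_ H) y y') (sym (w-loop G xi))) ⟩
    ind (_≟V_ G) xi xi (w H y y') + ind (_≟V_ H) y y' (w G xi xi)
      ≡⟨ sym (prodW-split G H xi xi y y') ⟩
    w T (xi , y) (xi , y') ∎
    where open ≡-Reasoning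

  w-pendant : ∀ a y y' → w S (just a , y) (nothing , y') ≡ ind (_≟V_ H) y y' (ind (_≟V_ G) a xi s)
  w-pendant a y y' =
    trans (prodW-split G' H (just a) nothing y y') (cong (_+ ind (_≟V_ H) y y' (ind (_≟V_ G) a xi s))
      (ind-no (_≟V_ G') {just a} {nothing} (w H y y') λ ()))

  pendant-ends : ∀ {a y y'} → 0 < w S (just a , y) (nothing , y') → a ≡ xi × y ≡ y'
  pendant-ends {a} {y} {y'} pos = a≡xi , y≡y'
    where
    pos' : 0 < ind (_≟V_ H) y y' (ind (_≟V_ G) a xi s)
    pos' = subst (0 <_) (w-pendant a y y') pos
    y≡y' : y ≡ y'
    y≡y' = ind-pos (_≟V_ H) y y' pos'
    a≡xi : a ≡ xi
    a≡xi = ind-pos (_≟V_ G) a xi (subst (0 <_) (ind-yes (_≟V_ H) {y} _ y≡y') pos')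

  pendant-weight : ∀ y → w S (just xi , y) (nothing , y) ≡ s
  pendant-weight y =
    trans (w-pendant xi y y) (trans (ind-yes (_≟V_ H) {y} _ refl) (ind-yes (_≟V_ G) {xi} s refl))

  φ-additive : ∀ D F t → Φ (λ z → D z + F z) t ≡ Φ D t + Φ F t
  φ-additive D F (x , y) = begin
    (D (just x , y) + F (just x , y)) + [x=xi] (s * (D (nothing , y) + F (nothing , y)))
      ≡⟨ cong ((D (just x , y) + F (just x , y)) +_)
              (trans (cong [x=xi] (*-distribˡ-+ s _ _)) (ind-+ (_≟V_ G) x xi _ _)) ⟩
    (D (just x , y) + F (just x , y)) + ([x=xi] (s * D (nothing , y)) + [x=xi] (s * F (nothing , y)))
      ≡⟨ interchange (D (just x , y)) _ _ _ ⟩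
    Φ D (x , y) + Φ F (x , y) ∎
    where
    open ≡-Reasoning
    [x=xi] : ℕ → ℕ
    [x=xi] = ind (_≟V_ G) x xi

  φ-cong : ∀ {D D'} → (∀ z → D z ≡ D' z) → ∀ t → Φ D t ≡ Φ D' t
  φ-cong D≡D' (x , y) =
    cong₂ (λ a b → a + ind (_≟V_ G) x xi (s * b)) (D≡D' (just x , y)) (D≡D' (nothing , y))

  φ-balance : ∀ (D E F F' : Dist (Maybe V × B)) {M M' : Dist (V × B)} → (∀ z → E z + F z ≡ D z + F' z) →
    (∀ t → Φ F t ≡ M t) → (∀ t → Φ F' t ≡ M' t) → ∀ t → Φ E t + M t ≡ Φ D t + M' t
  φ-balance D E F F' {M} {M'} bal ΦF≡M ΦF'≡M' t = begin
    Φ E t + M t                 ≡⟨ cong (Φ E t +_) (sym (ΦF≡M t)) ⟩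
    Φ E t + Φ F t               ≡⟨ sym (φ-additive E F t) ⟩
    Φ (λ z → E z + F z) t       ≡⟨ φ-cong bal t ⟩
    Φ (λ z → D z + F' z) t      ≡⟨ φ-additive D F' t ⟩
    Φ D t + Φ F' t              ≡⟨ cong (Φ D t +_) (ΦF'≡M' t) ⟩
    Φ D t + M' t                ∎
    where open ≡-Reasoning

  φ-mono : ∀ {D D'} → D ≤ᴰ D' → Φ D ≤ᴰ Φ D'
  φ-mono D≤D' (x , y) =
    +-mono-≤ (D≤D' (just x , y)) (ind-mono (_≟V_ G) x xi (*-monoʳ-≤ s (D≤D' (nothing , y))))

  φ-mass-inner : ∀ a y k t → Φ (mass S (just a , y) k) t ≡ mass T (a , y) k t
  φ-mass-inner a y k (x , y') = begin
    ind (_≟V_ S) (just x , y') (just a , y) k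
      + ind (_≟V_ G) x xi (s * ind (_≟V_ S) (nothing , y') (just a , y) k)
      ≡⟨ cong₂ _+_ inner no-pendant ⟩
    ind (_≟V_ T) (x , y') (a , y) k + 0
      ≡⟨ +-identityʳ _ ⟩
    ind (_≟V_ T) (x , y') (a , y) k ∎
    where
    open ≡-Reasoning
    inner : ind (_≟V_ S) (just x , y') (just a , y) k ≡ ind (_≟V_ T) (x , y') (a , y) k
    inner = trans (ind-× (_≟V_ G') (_≟V_ H) (_≟V_ S) (just x) (just a) y' y k)
           (trans (ind-just (_≟V_ G) (_≟V_ G') x a _)
                  (sym (ind-× (_≟V_ G) (_≟V_ H) (_≟V_ T) x a y' y k)))
    no-pendant : ind (_≟V_ G) x xi (s * ind (_≟V_ S) (nothing , y') (just a , y) k) ≡ 0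
    no-pendant = trans (cong (λ j → ind (_≟V_ G) x xi (s * j)) (ind-no (_≟V_ S) {nothing , y'} {just a , y} k λ ()))
                (trans (cong (ind (_≟V_ G) x xi) (*-zeroʳ s)) (ind-zero (_≟V_ G) x xi))

  φ-mass-pendant : ∀ y k t → Φ (mass S (nothing , y) k) t ≡ mass T (xi , y) (s * k) t
  φ-mass-pendant y k (x , y') = begin
    ind (_≟V_ S) (just x , y') (nothing , y) k
      + ind (_≟V_ G) x xi (s * ind (_≟V_ S) (nothing , y') (nothing , y) k)
      ≡⟨ cong₂ _+_ (ind-no (_≟V_ S) {just x , y'} {nothing , y} k λ ())
                   (cong (λ j → ind (_≟V_ G) x xi (s * j)) fibre) ⟩
    ind (_≟V_ G) x xi (s * ind (_≟V_ H) y' y k)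
      ≡⟨ cong (ind (_≟V_ G) x xi) (sym (ind-* (_≟V_ H) y' y s k)) ⟩
    ind (_≟V_ G) x xi (ind (_≟V_ H) y' y (s * k))
      ≡⟨ sym (ind-× (_≟V_ G) (_≟V_ H) (_≟V_ T) x xi y' y (s * k)) ⟩
    ind (_≟V_ T) (x , y') (xi , y) (s * k) ∎
    where
    open ≡-Reasoning
    fibre : ind (_≟V_ S) (nothing , y') (nothing , y) k ≡ ind (_≟V_ H) y' y k
    fibre = trans (ind-× (_≟V_ G') (_≟V_ H) (_≟V_ S) nothing nothing y' y k)
                  (ind-yes (_≟V_ G') {nothing} _ refl)

  project-inner-move : ∀ {D E} a b y y' → let k = w S (just a , y) (just b , y') in 0 < k →
    (∀ z → E z + mass S (just a , y) k z ≡ D z + mass S (just b , y') 1 z) → Reachable T (Φ D) (Φ E)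
  project-inner-move {D} {E} a b y y' pos bal =
    move T (subst (0 <_) k≡ pos) λ t → ≤-reflexive (trans
      (cong (λ j → Φ E t + mass T (a , y) j t) (sym k≡))
      (φ-balance D E (mass S (just a , y) k) (mass S (just b , y') 1) bal
                 (φ-mass-inner a y k) (φ-mass-inner b y' 1) t))
    where
    k : ℕ
    k = w S (just a , y) (just b , y')
    k≡ : k ≡ w T (a , y) (b , y')
    k≡ = w-inner a b y y'

  project-fibre-move : ∀ {D E} y y' → let k = w S (nothing , y) (nothing , y') in 0 < k →
    (∀ z → E z + mass S (nothing , y) k z ≡ D z + mass S (nothing , y') 1 z) → Reachable T (Φ D) (Φ E)
  project-fibre-move {D} {E} y y' pos bal =
    moves T s (subst (0 <_) k≡ pos) λ t → ≤-reflexive (trans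
      (cong (λ j → Φ E t + mass T (xi , y) (s * j) t) (sym k≡))
      (trans (φ-balance D E (mass S (nothing , y) k) (mass S (nothing , y') 1) bal
                        (φ-mass-pendant y k) (φ-mass-pendant y' 1) t)
             (cong (λ j → Φ D t + mass T (xi , y') j t) (*-identityʳ s))))
    where
    k : ℕ
    k = w S (nothing , y) (nothing , y')
    k≡ : k ≡ w T (xi , y) (xi , y')
    k≡ = w-fibre y y'

  project-outward-move : ∀ {D E} y → let k = w S (just xi , y) (nothing , y) in
    (∀ z → E z + mass S (just xi , y) k z ≡ D z + mass S (nothing , y) 1 z) → Reachable T (Φ D) (Φ E)
  project-outward-move {D} {E} y bal = reach-≤ T λ t → ≤-by-balance
    (φ-balance D E (mass S (just xi , y) k) (mass S (nothing , y) 1) bal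
               (φ-mass-inner xi y k) (φ-mass-pendant y 1) t)
    (ind-mono (_≟V_ T) t (xi , y) (≤-reflexive (trans (*-identityʳ s) (sym (pendant-weight y)))))
    where
    k : ℕ
    k = w S (just xi , y) (nothing , y)

  project-inward-move : ∀ {D E} y → let k = w S (nothing , y) (just xi , y) in 0 < k →
    (∀ z → E z + mass S (nothing , y) k z ≡ D z + mass S (just xi , y) 1 z) → Reachable T (Φ D) (Φ E)
  project-inward-move {D} {E} y pos bal = reach-≤ T λ t → ≤-by-balance
    (φ-balance D E (mass S (nothing , y) k) (mass S (just xi , y) 1) bal
               (φ-mass-pendant y k) (φ-mass-inner xi y 1) t)
    (ind-mono (_≟V_ T) t (xi , y) 1≤s*k)
    where
    k : ℕ
    k = w S (nothing , y) (just xi , y)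
    k≡s : k ≡ s
    k≡s = trans (w-sym S (nothing , y) (just xi , y)) (pendant-weight y)
    -- the edge exists, so s = k ≥ 1
    1≤s*k : 1 ≤ s * k
    1≤s*k = subst (λ j → 1 ≤ j * k) k≡s (*-mono-≤ pos pos)

  project-move : ∀ {D E} u v → 0 < w S u v →
    (∀ z → E z + mass S u (w S u v) z ≡ D z + mass S v 1 z) → Reachable T (Φ D) (Φ E)
  project-move (just a , y) (just b , y') pos bal = project-inner-move a b y y' pos bal
  project-move (nothing , y) (nothing , y') pos bal = project-fibre-move y y' pos bal
  project-move (just a , y) (nothing , y') pos bal with pendant-ends pos
  ... | refl , refl = project-outward-move y bal
  project-move (nothing , y) (just a , y') pos bal
    with pendant-ends (subst (0 <_) (w-sym S (nothing , y) (just a , y')) pos)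
  ... | refl , refl = project-inward-move y pos bal

  project-step : ∀ {D E} → Step S D E → Reachable T (Φ D) (Φ E)
  project-step (u , v , pos , k≤Du , E≡) = project-move u v pos (balance S u v _ k≤Du E≡)

  project-run : ∀ {D E} → Star (Step S) D E → Reachable T (Φ D) (Φ E)
  project-run ε            = reach-≤ T λ _ → ≤-refl
  project-run (st ◅ run)   = reach-trans T (project-step st) (project-run run)

-- Proposition 4.4.
proposition4p4 : {n m : ℕ} (G : WGraph (Fin n)) (H : WGraph (Fin m)) (s : ℕ) → 0 < s →
    (xi : Fin n) (D₀ Dₙ : Dist (Maybe (Fin n) × Fin m)) →
    Reachable (addPendant G xi s ×G H) D₀ Dₙ →
    Reachable (G ×G H) (φ G xi s D₀) (φ G xi s Dₙ)
proposition4p4 G H s _ xi D₀ Dₙ (D , run , Dₙ≤D) =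
  reach-trans T (project-run run) (reach-≤ T (φ-mono Dₙ≤D))
  where open Pendant G H s xi
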